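{- Let $c$ be a Coxeter element of $A_n$. For every $c$-singleton $w$, we have $\mathcal{U}_c\,\Pi_c(X(w))=o(w)$.
   Context: $A_n$ is the symmetric group on $[n+1]$, $s_i$ exchanges $i,i+1$, permutations compose as functions. A Coxeter element is $c=s_{a_1}\cdots s_{a_n}$ with $(a_1,\dots,a_n)$ a permutation of $[n]$. $\mathrm{sort}_c(w)$ is the lexicographically first subword of $c^\infty=a_1\cdots a_na_1\cdots a_n\cdots$ that is a reduced word for $w$; $w$ is $c$-sortable if the sets $K_j$ of letters taken from the $j$-th copy satisfy $K_1\supseteq K_2\supseteq\cdots$; $\pi^c_\downarrow(w)$ is the largest $c$-sortable element weakly below $w$ in right weak order; a $c$-singleton is a $c$-sortable $w$ with $(\pi^c_\downarrow)^{ -1}(w)=\{w\}$. $X(w)$ is the permutation matrix with $1$ in position $(i,w(i))$. For $i\in\{2,\dots,n\}$, $i$ is lower-barred if $i-1$ precedes $i$ in $(a_1,\dots,a_n)$, upper-barred otherwise; $d_1<\dots<d_r$ are the lower-barred and $u_1<\dots<u_s$ the upper-barred numbers. As a permutation, $c$ is the cycle $1\mapsto d_1\mapsto\cdots\mapsto d_r\mapsto n+1\mapsto u_s\mapsto\cdots\mapsto u_1\mapsto1$. Let $N=\binom{n+1}{2}$. Projection $\Pi_c:\mathbb{R}^{(n+1)\times(n+1)}\to\mathbb{R}^N$: list, for $k=1,\dots,r$, positions $(d_k-1,d_k),\dots,(1,d_k)$; then $(n,n+1),\dots,(1,n+1)$; then for each upper-barred $u$ in decreasing order, with $m=\min(u-1,n+1-u)$,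 positions $(n+1,c(u)),(n,c^2(u)),\dots,(n+2-m,c^m(u))$, followed if $u>\frac{n+2}{2}$ by $(u-1,u),\dots,(m+1,u)$. Reverse this list of $N$ positions; $\Pi_c(X)$ has $k$-th coordinate equal to the entry of $X$ at the $k$-th position of the reversed list. Let $R_c$ be the word $[(d_1-1)\cdots 1][(d_2-1)\cdots1]\cdots[(d_r-1)\cdots 1][n\cdots 1][n\cdots(n-u_s+2)]\cdots[n\cdots(n-u_1+2)]$, where each bracket is a decreasing run of consecutive integers; it has length $N$, write $R_c=[R(1)\cdots R(N)]$. Let $H_c$ be its heap: the poset on $\{1,\dots,N\}$ generated by $x\prec y$ whenever $x<y$ and $|R(x)-R(y)|\le1$. For $1\le i\le N$ let $b_i=s_{R(1)}\cdots s_{R(i)}$. The map sending an order ideal $I=\{z_1<\cdots<z_m\}$ of $H_c$ to $s_{R(z_1)}\cdots s_{R(z_m)}$ is a bijection from order ideals of $H_c$ onto $c$-singletons; let $f(w)$ be the order ideal corresponding to the $c$-singleton $w$. Define $o(w)\in\mathbb{R}^N$ by $o(w)_k=1$ if $N+1-k\in f(w)$ and $0$ otherwise (so $o(b_i)$ has its last $i$ entries equal to $1$ and the others $0$). $\mathcal{U}_c$ is the unique $N\times N$ lower unitriangular matrix with $\mathcal{U}_c\,\Pi_c(X(b_i))=o(b_i)$ for all $1\le i\le N$. -}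

module Defs where

open import Data.Nat using (ℕ; zero; suc; _+_; _*_; _∸_; _≤_; _<_; _<?_; _≟_; _≡ᵇ_; _%_; ∣_-_∣; _⊓_)
open import Data.Nat.Combinatorics using (_C_)
open import Data.Bool using (Bool; true; false; if_then_else_)
open import Data.List using (List; []; _∷_; map; filter; length; reverse; upTo; _++_; take; concatMap; foldl)
open import Data.List.Membership.Propositional using (_∈_)
open import Data.List.Membership.DecPropositional _≟_ using (_∈?_)
open import Data.List.Relation.Binary.Permutation.Propositional using (_↭_)
open import Data.List.Relation.Unary.Linked using (Linked)
open import Data.List.Relation.Unary.All using (All)
open import Data.Product using (_×_; _,_; ∃; proj₁; proj₂)
open import Data.Fin using (Fin; toℕ)
open import Data.Rational using (ℚ; 0ℚ; 1ℚ) renaming (_+_ to _+ℚ_; _*_ to _*ℚ_)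
open import Relation.Binary.PropositionalEquality using (_≡_)
open import Relation.Binary.Construct.Closure.ReflexiveTransitive using (Star)
open import Relation.Nullary.Decidable using (⌊_⌋; ¬?)

range1 : ℕ → List ℕ
range1 n = map suc (upTo n)

downFrom1 : ℕ → List ℕ
downFrom1 zero = []
downFrom1 (suc k) = suc k ∷ downFrom1 k

range2 : ℕ → List ℕ
range2 n = map (λ k → k + 2) (upTo (n ∸ 1))

nthD : {A : Set} → A → ℕ → List A → A
nthD d _ [] = d
nthD d zero (x ∷ _) = x
nthD d (suc k) (_ ∷ xs) = nthD d k xs

-- 0-based position of x in a list (length of the list if absent)
indexOf : ℕ → List ℕ → ℕ
indexOf x [] = 0
indexOf x (y ∷ ys) = if x ≡ᵇ y then 0 else suc (indexOf x ys)

iterate : (ℕ → ℕ) → ℕ → ℕ → ℕ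
iterate f zero x = x
iterate f (suc t) x = f (iterate f t x)

-- The symmetric group on [n+1], elements in one-line notation
-- w = [w(1), ..., w(n+1)]

Perm : Set
Perm = List ℕ

idPerm : ℕ → Perm
idPerm n = range1 (suc n)

IsPerm : ℕ → Perm → Set
IsPerm n w = w ↭ idPerm n

app : Perm → ℕ → ℕ
app w i = nthD i (i ∸ 1) w

-- composition as functions: (u v)(x) = u(v(x))
compose : Perm → Perm → Perm
compose u v = map (app u) v

inverse : ℕ → Perm → Perm
inverse n w = map (λ j → suc (indexOf j w)) (idPerm n)

-- right multiplication by s_i : swaps positions i, i+1 of the one-line notation
swapAt : ℕ → Perm → Perm
swapAt (suc zero) (x ∷ y ∷ r) = y ∷ x ∷ r
swapAt (suc (suc i)) (x ∷ r) = x ∷ swapAt (suc i) r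
swapAt _ l = l

evalWord : ℕ → List ℕ → Perm
evalWord n ws = foldl (λ p i → swapAt i p) (idPerm n) ws

-- Coxeter length = number of inversions
len : Perm → ℕ
len [] = 0
len (x ∷ r) = length (filter (λ y → y <? x) r) + len r

IsReducedWord : ℕ → List ℕ → Perm → Set
IsReducedWord n ws w = (evalWord n ws ≡ w) × (length ws ≡ len w)

WeakLe : ℕ → Perm → Perm → Set
WeakLe n u w = len u + len (compose (inverse n u) w) ≡ len w

IsCoxeterWord : ℕ → List ℕ → Set
IsCoxeterWord n a = a ↭ range1 n

coxElem : ℕ → List ℕ → Perm
coxElem n a = evalWord n a

-- letter at position k (0-based) of c^∞ = a_1 ... a_n a_1 ... a_n ...
-- (position k lies in copy number ⌊k/n⌋ (0-based))
cinf : List ℕ → ℕ → ℕ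
cinf [] k = 0
cinf (x ∷ xs) k = nthD 0 (k % suc (length xs)) (x ∷ xs)

data LexLe : List ℕ → List ℕ → Set where
  nil   : ∀ {q} → LexLe [] q
  here  : ∀ {x y p q} → x < y → LexLe (x ∷ p) (y ∷ q)
  there : ∀ {x p q} → LexLe p q → LexLe (x ∷ p) (x ∷ q)

IsReducedSubword : ℕ → List ℕ → Perm → List ℕ → Set
IsReducedSubword n a w p = Linked _<_ p × IsReducedWord n (map (cinf a) p) w

IsSortPositions : ℕ → List ℕ → Perm → List ℕ → Set
IsSortPositions n a w p =
  IsReducedSubword n a w p × (∀ q → IsReducedSubword n a w q → LexLe p q)

-- K_{j+1} ⊆ K_j for all j: a letter taken at position k+n (copy j+1)
-- is also taken at position k (the same letter in copy j)
Nested : List ℕ → List ℕ → Set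
Nested a p = ∀ k → (length a + k) ∈ p → k ∈ p

IsSortable : ℕ → List ℕ → Perm → Set
IsSortable n a w = ∃ λ p → IsSortPositions n a w p × Nested a p

IsPiDown : ℕ → List ℕ → Perm → Perm → Set
IsPiDown n a v u =
  IsPerm n u × IsSortable n a u × WeakLe n u v ×
  (∀ u' → IsPerm n u' → IsSortable n a u' → WeakLe n u' v → WeakLe n u' u)

IsSingleton : ℕ → List ℕ → Perm → Set
IsSingleton n a w =
  IsPerm n w × IsSortable n a w × (∀ v → IsPerm n v → IsPiDown n a v w → v ≡ w)

lowers : ℕ → List ℕ → List ℕ
lowers n a = filter (λ i → indexOf (i ∸ 1) a <? indexOf i a) (range2 n)

uppers : ℕ → List ℕ → List ℕ
uppers n a = filter (λ i → ¬? (indexOf (i ∸ 1) a <? indexOf i a)) (range2 n)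

Nc : ℕ → ℕ
Nc n = suc n C 2

uBlock : ℕ → Perm → ℕ → List (ℕ × ℕ)
uBlock n c u =
  map (λ t → (n + 2 ∸ t , iterate (app c) t u)) (range1 m)
  ++ (if ⌊ n + 2 <? 2 * u ⌋ then map (λ i → (i , u)) (take (u ∸ 1 ∸ m) (downFrom1 (u ∸ 1))) else [])
  where
  m : ℕ
  m = (u ∸ 1) ⊓ (suc n ∸ u)

posList : ℕ → List ℕ → List (ℕ × ℕ)
posList n a =
  concatMap (λ d → map (λ i → (i , d)) (downFrom1 (d ∸ 1))) (lowers n a)
  ++ map (λ i → (i , suc n)) (downFrom1 n)
  ++ concatMap (uBlock n (coxElem n a)) (reverse (uppers n a))

-- (n+1)×(n+1) matrices, 1-indexed entries
Matrix : Set
Matrix = ℕ → ℕ → ℚ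

X : Perm → Matrix
X w i j = if app w i ≡ᵇ j then 1ℚ else 0ℚ

Pi : (n : ℕ) → List ℕ → Matrix → Fin (Nc n) → ℚ
Pi n a M k = M (proj₁ p) (proj₂ p)
  where
  p : ℕ × ℕ
  p = nthD (0 , 0) (toℕ k) (reverse (posList n a))

Rword : ℕ → List ℕ → List ℕ
Rword n a =
  concatMap (λ d → downFrom1 (d ∸ 1)) (lowers n a)
  ++ downFrom1 n
  ++ concatMap (λ u → take (u ∸ 1) (downFrom1 n)) (reverse (uppers n a))

R : ℕ → List ℕ → ℕ → ℕ
R n a x = nthD 0 (x ∸ 1) (Rword n a)

HeapGen : ℕ → List ℕ → ℕ → ℕ → Set
HeapGen n a x y = (1 ≤ x) × (x < y) × (y ≤ Nc n) × (∣ R n a x - R n a y ∣ ≤ 1)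

HeapLe : ℕ → List ℕ → ℕ → ℕ → Set
HeapLe n a = Star (HeapGen n a)

IsOrderIdeal : ℕ → List ℕ → List ℕ → Set
IsOrderIdeal n a I =
  Linked _<_ I × All (λ z → (1 ≤ z) × (z ≤ Nc n)) I ×
  (∀ x y → y ∈ I → HeapLe n a x y → x ∈ I)

idealElem : ℕ → List ℕ → List ℕ → Perm
idealElem n a I = evalWord n (map (R n a) I)

bElem : ℕ → List ℕ → ℕ → Perm
bElem n a i = evalWord n (take i (Rword n a))

-- o-vector of an order ideal I: o_k = 1 iff N+1-k ∈ I (k 1-based; here k = toℕ k + 1)
oVec : (n : ℕ) → List ℕ → Fin (Nc n) → ℚ
oVec n I k = if ⌊ (Nc n ∸ toℕ k) ∈? I ⌋ then 1ℚ else 0ℚ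

sumFin : ∀ {m} → (Fin m → ℚ) → ℚ
sumFin {zero} f = 0ℚ
sumFin {suc m} f = f Fin.zero +ℚ sumFin (λ l → f (Fin.suc l))

mulMV : ∀ {m} → (Fin m → Fin m → ℚ) → (Fin m → ℚ) → Fin m → ℚ
mulMV U v k = sumFin (λ l → U k l *ℚ v l)

LowerUnitriangular : ∀ {m} → (Fin m → Fin m → ℚ) → Set
LowerUnitriangular U = (∀ k → U k k ≡ 1ℚ) × (∀ k l → toℕ k < toℕ l → U k l ≡ 0ℚ)

-- U is 𝒰_c: lower unitriangular with U Π_c(X(b_i)) = o(b_i) for 1 ≤ i ≤ N
-- (f(b_i) = {1, ..., i})
IsUc : (n : ℕ) → List ℕ → (Fin (Nc n) → Fin (Nc n) → ℚ) → Set
IsUc n a U =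
  LowerUnitriangular U ×
  (∀ i → 1 ≤ i → i ≤ Nc n → ∀ k → mulMV U (Pi n a (X (bElem n a i))) k ≡ oVec n (range1 i) k)

module Submission where

-- Write I = {z₁ < ⋯ < z_m}, let w_k be the product of the s_{R(z_i)} with z_i ≤ k (so w_N = w)
-- and b_k = s_{R(1)} ⋯ s_{R(k)}. The map f ↦ 𝒰_c Π_c X(f) is linear, and X(f s_r) − X(f)
-- only depends on f(r) and f(r + 1). If k + 1 ∈ I and r = R(k + 1), tracing the values r and
-- r + 1 back through the letters k, …, 1 only meets letters below k + 1 in the heap, which lie
-- in I; so w_k and b_k agree on r and r + 1, and 𝒰_c Π_c X(w_{k+1}) − 𝒰_c Π_c X(w_k) equals
-- o(b_{k+1}) − o(b_k), the indicator of k + 1. Induction on k from b_0 = w_0 = e then gives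
-- o(I), provided 𝒰_c Π_c X(e) = 0, i.e. Π_c reads no diagonal entry. The only positions where
-- this is not obvious are (n + 2 − t, c^t(u)) for upper-barred u and t ≤ min(u − 1, n + 1 − u);
-- there c^t(u) < u ≤ n + 1 − t, because the cycle of c leaving u runs through u_{j−1}, …, u_1,
-- 1 and then the lower-barred numbers below u, which are exactly the u − 1 numbers below u.

open import Defs
open import Algebra.Bundles using (CommutativeMonoid)
open import Data.Bool using (Bool; true; false; if_then_else_; _∧_)
open import Data.Bool.Properties using (∧-identityʳ; ∧-zeroʳ; T-≡)
open import Data.Empty using (⊥; ⊥-elim)
open import Data.Fin using (Fin; toℕ)
open import Data.Fin.Properties using (toℕ<n)
open import Data.Nat using (ℕ; zero; suc; pred; _+_; _*_; _∸_; _⊓_; _≤_; _<_; _≟_; _≡ᵇ_; _≤?_; _<?_;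
  z≤n; s≤s; s≤s⁻¹; ∣_-_∣)
open import Data.Nat.Properties
open import Data.List using (List; []; _∷_; map; length; foldl; upTo; applyUpTo; take; reverse)
open import Data.List.Properties using (length-map; length-upTo; map-upTo; take-all)
open import Data.List.Membership.Propositional using (_∈_; _∉_)
open import Data.List.Membership.Propositional.Properties using (∈-map⁺; ∈-map⁻; ∈-upTo⁺; ∈-upTo⁻; ∈-filter⁻)
open import Data.List.Membership.DecPropositional _≟_ using (_∈?_)
open import Data.List.Relation.Binary.Permutation.Propositional using (↭-sym; ↭⇒↭ₛ)
open import Data.List.Relation.Binary.Permutation.Propositional.Properties
  using (↭-length; ∈-resp-↭; All-resp-↭; ↭-reverse)
open import Data.List.Relation.Binary.Permutation.Setoid.Properties using (Unique-resp-↭)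
open import Data.List.Relation.Unary.All as All using (All; []; _∷_)
open import Data.List.Relation.Unary.All.Properties using (All¬⇒¬Any; ++⁺; concat⁺; map⁺; take⁺)
open import Data.List.Relation.Unary.AllPairs using (AllPairs; []; _∷_)
import Data.List.Relation.Unary.Any as Any
open import Data.List.Relation.Unary.Linked.Properties using (Linked⇒AllPairs)
open import Data.List.Relation.Unary.Unique.Propositional using (Unique)
import Data.List.Relation.Unary.Unique.Propositional.Properties as Unique
open import Data.Product as Product using (_×_; _,_; proj₁; proj₂; ∃)
open import Data.Rational using (ℚ; 0ℚ; 1ℚ) renaming (_+_ to _+ℚ_; _*_ to _*ℚ_)
import Data.Rational.Properties as ℚ
open import Data.Sum as Sum using (_⊎_; inj₁; inj₂)
open import Function using (id; _∘_)
open import Function.Bundles using (Equivalence; mk⇔)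
open import Relation.Binary.Construct.Closure.ReflexiveTransitive using (ε; _◅_)
open import Relation.Binary.Definitions using (tri<; tri≈; tri>)
open import Relation.Binary.PropositionalEquality
open import Relation.Nullary using (¬_; ¬?; Dec; yes; no; contradiction)
open import Relation.Nullary.Decidable using (⌊_⌋; _×-dec_; _⊎-dec_; isYes≗does; dec-true; dec-false; does-⇔)
open import Relation.Unary using (Decidable)

open import Algebra.Properties.Group ℚ.+-0-group using (∙-cancelʳ)
open import Algebra.Properties.CommutativeSemigroup
  (CommutativeMonoid.commutativeSemigroup ℚ.+-0-commutativeMonoid) using (interchange)

-- Adjacent transpositions and words acting on ℕ

Touches : ℕ → ℕ → Set
Touches i x = x ≡ i ⊎ x ≡ suc i

∣n-1+n∣≡1 : ∀ m → ∣ m - suc m ∣ ≡ 1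
∣n-1+n∣≡1 zero = refl
∣n-1+n∣≡1 (suc m) = ∣n-1+n∣≡1 m

touches-near : ∀ {i j x} → Touches i x → Touches j x → ∣ i - j ∣ ≤ 1
touches-near {i} (inj₁ refl) (inj₁ refl) = subst (_≤ 1) (sym (∣n-n∣≡0 i)) z≤n
touches-near {j = j} (inj₁ refl) (inj₂ refl) = ≤-reflexive (trans (∣-∣-comm (suc j) j) (∣n-1+n∣≡1 j))
touches-near {i} (inj₂ refl) (inj₁ refl) = ≤-reflexive (∣n-1+n∣≡1 i)
touches-near {i} (inj₂ refl) (inj₂ refl) = subst (_≤ 1) (sym (∣n-n∣≡0 i)) z≤n

touches? : ∀ i x → Dec (Touches i x)
touches? i x = (x ≟ i) ⊎-dec (x ≟ suc i)

swap : ℕ → ℕ → ℕ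
swap i x with x ≟ i
... | yes _ = suc i
... | no _ with x ≟ suc i
...   | yes _ = i
...   | no _ = x

swap-left : ∀ i → swap i i ≡ suc i
swap-left i with i ≟ i
... | yes _ = refl
... | no i≢i = contradiction refl i≢i

swap-right : ∀ i → swap i (suc i) ≡ i
swap-right i with suc i ≟ i
... | yes 1+i≡i = contradiction 1+i≡i 1+n≢n
... | no _ with suc i ≟ suc i
...   | yes _ = refl
...   | no ne = contradiction refl ne

swap-moved : ∀ i x → swap i x ≢ x → Touches i x × Touches i (swap i x)
swap-moved i x moved with x ≟ i
... | yes x≡i = inj₁ x≡i , inj₂ refl
... | no _ with x ≟ suc i
...   | yes x≡1+i = inj₂ x≡1+i , inj₁ refl
...   | no _ = contradiction refl moved

swap-fixes : ∀ {i x} → ¬ Touches i x → swap i x ≡ x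
swap-fixes {i} {x} untouched with swap i x ≟ x
... | yes fixed = fixed
... | no moved = contradiction (proj₁ (swap-moved i x moved)) untouched

swap-positive : ∀ {i x} → 1 ≤ i → 1 ≤ x → 1 ≤ swap i x
swap-positive {i} {x} 1≤i 1≤x with x ≟ i
... | yes _ = s≤s z≤n
... | no _ with x ≟ suc i
...   | yes _ = 1≤i
...   | no _ = 1≤x

InRange : ℕ → ℕ → Set
InRange n i = 1 ≤ i × i ≤ n

-- s_i ∈ A_n acting on ℕ; as for swapAt, letters outside [1, n] act trivially
sAct : ℕ → ℕ → ℕ → ℕ
sAct n i x with (1 ≤? i) ×-dec (i ≤? n)
... | yes _ = swap i x
... | no _ = x

sAct-inRange : ∀ {n i} x → InRange n i → sAct n i x ≡ swap i x
sAct-inRange {n} {i} x r with (1 ≤? i) ×-dec (i ≤? n)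
... | yes _ = refl
... | no ¬r = contradiction r ¬r

sAct-outOfRange : ∀ {n i} x → ¬ InRange n i → sAct n i x ≡ x
sAct-outOfRange {n} {i} x ¬r with (1 ≤? i) ×-dec (i ≤? n)
... | yes r = contradiction r ¬r
... | no _ = refl

sAct-moved : ∀ n i x → sAct n i x ≢ x → Touches i x × Touches i (sAct n i x)
sAct-moved n i x moved with (1 ≤? i) ×-dec (i ≤? n)
... | yes _ = swap-moved i x moved
... | no _ = contradiction refl moved

sAct-fixes : ∀ n i x → ¬ Touches i x → sAct n i x ≡ x
sAct-fixes n i x untouched with (1 ≤? i) ×-dec (i ≤? n)
... | yes _ = swap-fixes untouched
... | no _ = refl

sAct-positive : ∀ n i {x} → 1 ≤ x → 1 ≤ sAct n i x
sAct-positive n i 1≤x with (1 ≤? i) ×-dec (i ≤? n)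
... | yes (1≤i , _) = swap-positive 1≤i 1≤x
... | no _ = 1≤x

wordAct : ℕ → List ℕ → ℕ → ℕ
wordAct n [] x = x
wordAct n (i ∷ ws) x = sAct n i (wordAct n ws x)

wordAct-positive : ∀ n ws {x} → 1 ≤ x → 1 ≤ wordAct n ws x
wordAct-positive n [] 1≤x = 1≤x
wordAct-positive n (i ∷ ws) 1≤x = sAct-positive n i (wordAct-positive n ws 1≤x)

wordAct-take-suc : ∀ n L k y → wordAct n (take (suc k) L) y ≡ wordAct n (take k L) (sAct n (nthD 0 k L) y)
wordAct-take-suc n [] zero y = sym (sAct-outOfRange {n} {0} y λ { (() , _) })
wordAct-take-suc n [] (suc k) y = sym (sAct-outOfRange {n} {0} y λ { (() , _) })
wordAct-take-suc n (x ∷ L) zero y = refl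
wordAct-take-suc n (x ∷ L) (suc k) y = cong (sAct n x) (wordAct-take-suc n L k y)

wordAct-take-skip : ∀ n L {j k} x → j ≤ k → (∀ i → j ≤ i → i < k → sAct n (nthD 0 i L) x ≡ x) →
  wordAct n (take k L) x ≡ wordAct n (take j L) x
wordAct-take-skip n L {k = zero} x z≤n _ = refl
wordAct-take-skip n L {j} {suc k} x j≤1+k fixes with m≤n⇒m<n∨m≡n j≤1+k
... | inj₂ refl = refl
... | inj₁ (s≤s j≤k) =
  trans (wordAct-take-suc n L k x)
        (trans (cong (wordAct n (take k L)) (fixes k j≤k ≤-refl))
               (wordAct-take-skip n L x j≤k (λ i j≤i i<k → fixes i j≤i (m≤n⇒m≤1+n i<k))))

nthD-default-irrelevant : ∀ {A : Set} (d d′ : A) j W → j < length W → nthD d j W ≡ nthD d′ j W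
nthD-default-irrelevant d d′ zero (x ∷ W) _ = refl
nthD-default-irrelevant d d′ (suc j) (x ∷ W) (s≤s j<len) = nthD-default-irrelevant d d′ j W j<len

nthD-swapAt-left : ∀ (d : ℕ) i W → suc i < length W → nthD d i (swapAt (suc i) W) ≡ nthD d (suc i) W
nthD-swapAt-left d zero (x ∷ y ∷ W) _ = refl
nthD-swapAt-left d zero (x ∷ []) (s≤s ())
nthD-swapAt-left d (suc i) (x ∷ W) (s≤s i<len) = nthD-swapAt-left d i W i<len

nthD-swapAt-right : ∀ (d : ℕ) i W → suc i < length W → nthD d (suc i) (swapAt (suc i) W) ≡ nthD d i W
nthD-swapAt-right d zero (x ∷ y ∷ W) _ = refl
nthD-swapAt-right d zero (x ∷ []) (s≤s ())
nthD-swapAt-right d (suc i) (x ∷ W) (s≤s i<len) = nthD-swapAt-right d i W i<len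

nthD-swapAt-other : ∀ (d : ℕ) i j W → ¬ Touches i j → nthD d j (swapAt (suc i) W) ≡ nthD d j W
nthD-swapAt-other d zero zero (x ∷ y ∷ W) untouched = contradiction (inj₁ refl) untouched
nthD-swapAt-other d zero (suc zero) (x ∷ y ∷ W) untouched = contradiction (inj₂ refl) untouched
nthD-swapAt-other d zero (suc (suc j)) (x ∷ y ∷ W) _ = refl
nthD-swapAt-other d zero j [] _ = refl
nthD-swapAt-other d zero j (x ∷ []) _ = refl
nthD-swapAt-other d (suc i) j [] _ = refl
nthD-swapAt-other d (suc i) zero (x ∷ W) _ = refl
nthD-swapAt-other d (suc i) (suc j) (x ∷ W) untouched =
  nthD-swapAt-other d i j W (untouched ∘ Sum.map (cong suc) (cong suc))

swapAt-beyond : ∀ i (W : List ℕ) → length W ≤ i → swapAt i W ≡ W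
swapAt-beyond zero W _ = refl
swapAt-beyond (suc zero) [] _ = refl
swapAt-beyond (suc zero) (x ∷ []) _ = refl
swapAt-beyond (suc zero) (x ∷ y ∷ W) (s≤s ())
swapAt-beyond (suc (suc i)) [] _ = refl
swapAt-beyond (suc (suc i)) (x ∷ W) (s≤s len≤i) = cong (x ∷_) (swapAt-beyond (suc i) W len≤i)

length-swapAt : ∀ i (W : List ℕ) → length (swapAt i W) ≡ length W
length-swapAt zero W = refl
length-swapAt (suc zero) [] = refl
length-swapAt (suc zero) (x ∷ []) = refl
length-swapAt (suc zero) (x ∷ y ∷ W) = refl
length-swapAt (suc (suc i)) [] = refl
length-swapAt (suc (suc i)) (x ∷ W) = cong suc (length-swapAt (suc i) W)

app-swapAt-inRange : ∀ i W y → suc i < length W → app (swapAt (suc i) W) (suc y) ≡ app W (swap (suc i) (suc y))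
app-swapAt-inRange i W y i<len with touches? (suc i) (suc y)
... | yes (inj₁ refl) rewrite swap-left (suc i) =
  trans (nthD-swapAt-left _ i W i<len) (nthD-default-irrelevant _ _ (suc i) W i<len)
... | yes (inj₂ refl) rewrite swap-right (suc i) =
  trans (nthD-swapAt-right _ i W i<len) (nthD-default-irrelevant _ _ i W (<-trans (n<1+n i) i<len))
... | no untouched rewrite swap-fixes untouched =
  nthD-swapAt-other _ i y W (untouched ∘ Sum.map (cong suc) (cong suc))

app-swapAt : ∀ n i W y → length W ≡ suc n → 1 ≤ y → app (swapAt i W) y ≡ app W (sAct n i y)
app-swapAt n i W y lenW 1≤y with (1 ≤? i) ×-dec (i ≤? n)
app-swapAt n zero W y lenW 1≤y | no _ = refl
app-swapAt n (suc i) W y lenW 1≤y | no ¬r =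
  cong (λ V → app V y) (swapAt-beyond (suc i) W (subst (_≤ suc i) (sym lenW) (≮⇒≥ (λ i<n → ¬r (s≤s z≤n , s≤s⁻¹ i<n)))))
app-swapAt n (suc i) W (suc y) lenW 1≤y | yes (_ , i<n) =
  app-swapAt-inRange i W y (subst (suc i <_) (sym lenW) (s≤s i<n))

foldSwapAt : List ℕ → List ℕ → List ℕ
foldSwapAt W ws = foldl (λ p i → swapAt i p) W ws

length-foldSwapAt : ∀ ws W → length (foldSwapAt W ws) ≡ length W
length-foldSwapAt [] W = refl
length-foldSwapAt (i ∷ ws) W = trans (length-foldSwapAt ws (swapAt i W)) (length-swapAt i W)

app-foldSwapAt : ∀ n ws W x → length W ≡ suc n → 1 ≤ x → app (foldSwapAt W ws) x ≡ app W (wordAct n ws x)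
app-foldSwapAt n [] W x _ _ = refl
app-foldSwapAt n (i ∷ ws) W x lenW 1≤x =
  trans (app-foldSwapAt n ws (swapAt i W) x (trans (length-swapAt i W) lenW) 1≤x)
        (app-swapAt n i W (wordAct n ws x) lenW (wordAct-positive n ws 1≤x))

nthD-applyUpTo : ∀ (f : ℕ → ℕ) m j → nthD (f j) j (applyUpTo f m) ≡ f j
nthD-applyUpTo f zero j = refl
nthD-applyUpTo f (suc m) zero = refl
nthD-applyUpTo f (suc m) (suc j) = nthD-applyUpTo (f ∘ suc) m j

app-idPerm : ∀ n {x} → 1 ≤ x → app (idPerm n) x ≡ x
app-idPerm n {suc y} _ rewrite map-upTo suc (suc n) = nthD-applyUpTo suc (suc n) y

length-idPerm : ∀ n → length (idPerm n) ≡ suc n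
length-idPerm n = trans (length-map suc (upTo (suc n))) (length-upTo (suc n))

-- app w 0 = app w 1, since app reads position 0 ∸ 1 = 0
app-evalWord : ∀ n ws x → app (evalWord n ws) x ≡ wordAct n ws (suc (pred x))
app-evalWord n ws (suc y) =
  trans (app-foldSwapAt n ws (idPerm n) (suc y) (length-idPerm n) (s≤s z≤n))
        (app-idPerm n (wordAct-positive n ws (s≤s z≤n)))
app-evalWord n ws zero =
  trans (nthD-default-irrelevant 0 1 0 (evalWord n ws) 0<len) (app-evalWord n ws 1)
  where
  0<len : 0 < length (evalWord n ws)
  0<len = subst (0 <_) (sym (trans (length-foldSwapAt ws (idPerm n)) (length-idPerm n))) (s≤s z≤n)

⌊⌋-true : ∀ {A : Set} (a? : Dec A) → A → ⌊ a? ⌋ ≡ true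
⌊⌋-true a? a = trans (isYes≗does a?) (dec-true a? a)

⌊⌋-false : ∀ {A : Set} (a? : Dec A) → ¬ A → ⌊ a? ⌋ ≡ false
⌊⌋-false a? ¬a = trans (isYes≗does a?) (dec-false a? ¬a)

⌊⌋-⇔ : ∀ {A B : Set} → (A → B) → (B → A) → (a? : Dec A) (b? : Dec B) → ⌊ a? ⌋ ≡ ⌊ b? ⌋
⌊⌋-⇔ f g a? b? = trans (isYes≗does a?) (trans (does-⇔ (mk⇔ f g) a? b?) (sym (isYes≗does b?)))

≡ᵇ-true : ∀ {m n} → m ≡ n → (m ≡ᵇ n) ≡ true
≡ᵇ-true {m} {n} m≡n = Equivalence.to T-≡ (≡⇒≡ᵇ m n m≡n)

≡ᵇ-false : ∀ {m n} → m ≢ n → (m ≡ᵇ n) ≡ false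
≡ᵇ-false {m} {n} m≢n with m ≡ᵇ n in eq
... | false = refl
... | true = contradiction (≡ᵇ⇒≡ m n (Equivalence.from T-≡ eq)) m≢n

member : List ℕ → ℕ → Bool
member J y = ⌊ y ∈? J ⌋

member-here : ∀ y J → member (y ∷ J) y ≡ true
member-here y J = ⌊⌋-true (y ∈? y ∷ J) (Any.here refl)

member-there : ∀ {y y′ J} → y′ ≢ y → member (y ∷ J) y′ ≡ member J y′
member-there {y} {y′} {J} y′≢y = ⌊⌋-⇔ from Any.there (y′ ∈? y ∷ J) (y′ ∈? J)
  where
  from : y′ ∈ y ∷ J → y′ ∈ J
  from (Any.here y′≡y) = contradiction y′≡y y′≢y
  from (Any.there y′∈J) = y′∈J

member-below : ∀ {lo J} → All (lo <_) J → member J lo ≡ false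
member-below {lo} {J} lo<J = ⌊⌋-false (lo ∈? J) (All¬⇒¬Any (All.map <⇒≢ lo<J))

member-sound : ∀ {y J} → member J y ≡ true → y ∈ J
member-sound {y} {J} eq with y ∈? J
... | yes y∈J = y∈J

∈-range1⁺ : ∀ {m k} → InRange k m → m ∈ range1 k
∈-range1⁺ {suc m} (_ , m<k) = ∈-map⁺ suc (∈-upTo⁺ m<k)

∈-range1⁻ : ∀ {m k} → m ∈ range1 k → InRange k m
∈-range1⁻ m∈ with ∈-map⁻ suc m∈
... | _ , j∈ , refl = s≤s z≤n , ∈-upTo⁻ j∈

indexOf-∈ : ∀ {x xs} → x ∈ xs → indexOf x xs < length xs × nthD 0 (indexOf x xs) xs ≡ x
indexOf-∈ {x} {y ∷ ys} x∈ with x ≟ y | x∈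
... | yes refl | _ rewrite ≡ᵇ-true {x} refl = s≤s z≤n , refl
... | no x≢y | Any.here x≡y = contradiction x≡y x≢y
... | no x≢y | Any.there x∈ys rewrite ≡ᵇ-false x≢y = Product.map₁ s≤s (indexOf-∈ x∈ys)

indexOf-∉ : ∀ {x xs} → x ∉ xs → indexOf x xs ≡ length xs
indexOf-∉ {x} {[]} _ = refl
indexOf-∉ {x} {y ∷ ys} x∉ rewrite ≡ᵇ-false (x∉ ∘ Any.here) = cong suc (indexOf-∉ (x∉ ∘ Any.there))

indexOf-≤ : ∀ x xs → indexOf x xs ≤ length xs
indexOf-≤ x [] = z≤n
indexOf-≤ x (y ∷ ys) with x ≡ᵇ y
... | true = z≤n
... | false = s≤s (indexOf-≤ x ys)

nthD-∈ : ∀ {xs} i → i < length xs → nthD 0 i xs ∈ xs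
nthD-∈ {y ∷ ys} zero _ = Any.here refl
nthD-∈ {y ∷ ys} (suc i) (s≤s i<len) = Any.there (nthD-∈ i i<len)

indexOf-nthD : ∀ {xs} → Unique xs → ∀ i → i < length xs → indexOf (nthD 0 i xs) xs ≡ i
indexOf-nthD {y ∷ ys} _ zero _ rewrite ≡ᵇ-true {y} refl = refl
indexOf-nthD {y ∷ ys} (y∉ys ∷ unique) (suc i) (s≤s i<len)
  rewrite ≡ᵇ-false (≢-sym (All.lookup y∉ys (nthD-∈ i i<len))) = cong suc (indexOf-nthD unique i i<len)

nthD-All : ∀ {A : Set} {P : A → Set} {d : A} {xs} k → All P xs → P d → P (nthD d k xs)
nthD-All k [] Pd = Pd
nthD-All zero (Px ∷ _) _ = Px
nthD-All (suc k) (_ ∷ Pxs) Pd = nthD-All k Pxs Pd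

count : ∀ {P : ℕ → Set} → Decidable P → ℕ → ℕ
count P? zero = 0
count P? (suc y) with P? y
... | yes _ = suc (count P? y)
... | no _ = count P? y

module _ {P : ℕ → Set} (P? : Decidable P) where

  count-hit : ∀ {z} → P z → count P? (suc z) ≡ suc (count P? z)
  count-hit {z} Pz with P? z
  ... | yes _ = refl
  ... | no ¬Pz = contradiction Pz ¬Pz

  count-miss : ∀ {z} → ¬ P z → count P? (suc z) ≡ count P? z
  count-miss {z} ¬Pz with P? z
  ... | yes Pz = contradiction Pz ¬Pz
  ... | no _ = refl

  count-skip : ∀ {z x} → z < x → (∀ w → z < w → w < x → ¬ P w) → count P? x ≡ count P? (suc z)
  count-skip {z} {suc x} (s≤s z≤x) none with m≤n⇒m<n∨m≡n z≤x
  ... | inj₂ refl = refl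
  ... | inj₁ z<x = trans (count-miss (none x z<x ≤-refl)) (count-skip z<x (λ w z<w w<x → none w z<w (m≤n⇒m≤1+n w<x)))

All-if : ∀ {A : Set} {P : A → Set} b {xs : List A} → All P xs → All P (if b then xs else [])
All-if true Pxs = Pxs
All-if false _ = []

-- Linear algebra over ℚ

sumFin-cong : ∀ {m} {f g : Fin m → ℚ} → (∀ l → f l ≡ g l) → sumFin f ≡ sumFin g
sumFin-cong {zero} _ = refl
sumFin-cong {suc m} f≗g = cong₂ _+ℚ_ (f≗g Fin.zero) (sumFin-cong (f≗g ∘ Fin.suc))

sumFin-+ : ∀ {m} (f g : Fin m → ℚ) → sumFin f +ℚ sumFin g ≡ sumFin (λ l → f l +ℚ g l)
sumFin-+ {zero} f g = ℚ.+-identityʳ 0ℚ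
sumFin-+ {suc m} f g =
  trans (interchange (f Fin.zero) (sumFin (f ∘ Fin.suc)) (g Fin.zero) (sumFin (g ∘ Fin.suc)))
        (cong (f Fin.zero +ℚ g Fin.zero +ℚ_) (sumFin-+ (f ∘ Fin.suc) (g ∘ Fin.suc)))

sumFin-zero : ∀ {m} {f : Fin m → ℚ} → (∀ l → f l ≡ 0ℚ) → sumFin f ≡ 0ℚ
sumFin-zero {zero} _ = refl
sumFin-zero {suc m} f≗0 = trans (cong₂ _+ℚ_ (f≗0 Fin.zero) (sumFin-zero (f≗0 ∘ Fin.suc))) (ℚ.+-identityʳ 0ℚ)

module _ {m} (U : Fin m → Fin m → ℚ) where

  mulMV-cong : ∀ {v w} → (∀ l → v l ≡ w l) → ∀ K → mulMV U v K ≡ mulMV U w K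
  mulMV-cong v≗w K = sumFin-cong (λ l → cong (U K l *ℚ_) (v≗w l))

  mulMV-+ : ∀ v w K → mulMV U v K +ℚ mulMV U w K ≡ mulMV U (λ l → v l +ℚ w l) K
  mulMV-+ v w K =
    trans (sumFin-+ (λ l → U K l *ℚ v l) (λ l → U K l *ℚ w l)) (sumFin-cong (λ l → sym (ℚ.*-distribˡ-+ (U K l) (v l) (w l))))

  mulMV-zero : ∀ {v} → (∀ l → v l ≡ 0ℚ) → ∀ K → mulMV U v K ≡ 0ℚ
  mulMV-zero v≗0 K = sumFin-zero (λ l → trans (cong (U K l *ℚ_) (v≗0 l)) (ℚ.*-zeroʳ (U K l)))

Pi-cong : ∀ n a {M M′ : Matrix} → (∀ i j → M i j ≡ M′ i j) → ∀ K → Pi n a M K ≡ Pi n a M′ K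
Pi-cong n a M≗M′ K = M≗M′ _ _

Pi-+-cong : ∀ n a {M₁ M₂ M₃ M₄ : Matrix} → (∀ i j → M₁ i j +ℚ M₂ i j ≡ M₃ i j +ℚ M₄ i j) →
  ∀ K → Pi n a M₁ K +ℚ Pi n a M₂ K ≡ Pi n a M₃ K +ℚ Pi n a M₄ K
Pi-+-cong n a eq K = eq _ _

ind : Bool → ℚ
ind b = if b then 1ℚ else 0ℚ

-- row 0 repeats row 1, as it does for X
funMatrix : (ℕ → ℕ) → Matrix
funMatrix f i j = ind (f (suc (pred i)) ≡ᵇ j)

X-evalWord : ∀ n ws i j → X (evalWord n ws) i j ≡ funMatrix (wordAct n ws) i j
X-evalWord n ws i j = cong (λ v → ind (v ≡ᵇ j)) (app-evalWord n ws i)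

funMatrix-cong : ∀ {f g} → (∀ x → f x ≡ g x) → ∀ i j → funMatrix f i j ≡ funMatrix g i j
funMatrix-cong f≗g i j = cong (λ v → ind (v ≡ᵇ j)) (f≗g (suc (pred i)))

-- X(f s_r) − X(f) is determined by f(r) and f(r+1)
funMatrix-exchange : ∀ n r {f g : ℕ → ℕ} → (∀ {y} → Touches r y → f y ≡ g y) → ∀ i j →
  funMatrix (f ∘ sAct n r) i j +ℚ funMatrix g i j ≡ funMatrix (g ∘ sAct n r) i j +ℚ funMatrix f i j
funMatrix-exchange n r {f} {g} agree i j with sAct n r (suc (pred i)) ≟ suc (pred i)
... | yes fixed rewrite fixed = ℚ.+-comm (funMatrix f i j) (funMatrix g i j)
... | no moved rewrite agree (proj₁ (sAct-moved n r _ moved)) | agree (proj₂ (sAct-moved n r _ moved)) = refl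

≤?-suc-≢ : ∀ {m k} → m ≢ suc k → ⌊ m ≤? suc k ⌋ ≡ ⌊ m ≤? k ⌋
≤?-suc-≢ m≢1+k = ⌊⌋-⇔ (λ m≤1+k → s≤s⁻¹ (≤∧≢⇒< m≤1+k m≢1+k)) m≤n⇒m≤1+n _ _

-- o(S ∩ [1, k + 1]) − o(S ∩ [1, k]) = o([1, k + 1]) − o([1, k]) for k + 1 ∈ S, rearranged without subtraction
truncation-selected : ∀ (S : ℕ → Bool) k m → S (suc k) ≡ true →
  ind (S m ∧ ⌊ m ≤? suc k ⌋) +ℚ ind ⌊ m ≤? k ⌋ ≡ ind ⌊ m ≤? suc k ⌋ +ℚ ind (S m ∧ ⌊ m ≤? k ⌋)
truncation-selected S k m Sk with m ≟ suc k
... | yes refl rewrite Sk = refl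
... | no m≢1+k rewrite ≤?-suc-≢ m≢1+k = ℚ.+-comm (ind (S m ∧ ⌊ m ≤? k ⌋)) (ind ⌊ m ≤? k ⌋)

truncation-skipped : ∀ (S : ℕ → Bool) k m → S (suc k) ≡ false → (S m ∧ ⌊ m ≤? suc k ⌋) ≡ (S m ∧ ⌊ m ≤? k ⌋)
truncation-skipped S k m ¬Sk with m ≟ suc k
... | yes refl rewrite ¬Sk = refl
... | no m≢1+k rewrite ≤?-suc-≢ m≢1+k = refl

-- The heap H_c

module Heap (n : ℕ) (a : List ℕ) where

  N : ℕ
  N = Nc n

  letterAct : ℕ → ℕ → ℕ
  letterAct y = sAct n (R n a y)

  step : (ℕ → Bool) → ℕ → ℕ → ℕ
  step S y p = if S y then letterAct y p else p

  -- the product of the s_{R(y)} over lo ≤ y < lo + k with S y, in increasing order of y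
  subProduct : (ℕ → Bool) → ℕ → ℕ → ℕ → ℕ
  subProduct S lo zero p = p
  subProduct S lo (suc k) p = subProduct S lo k (step S (lo + k) p)

  full : ℕ → Bool
  full _ = true

  DownClosed : (ℕ → Bool) → Set
  DownClosed S = ∀ x y → HeapLe n a x y → S y ≡ true → S x ≡ true

  step-selected : ∀ {S y} p → S y ≡ true → step S y p ≡ letterAct y p
  step-selected {S} {y} p Sy rewrite Sy = refl

  step-skipped : ∀ {S y} p → S y ≡ false → step S y p ≡ p
  step-skipped {S} {y} p ¬Sy rewrite ¬Sy = refl

  step-fixed : ∀ S {y p} → letterAct y p ≡ p → step S y p ≡ p
  step-fixed S {y} {p} fixed with S y
  ... | true = fixed
  ... | false = refl

  subProduct-bottom : ∀ S lo k p → subProduct S lo (suc k) p ≡ step S lo (subProduct S (suc lo) k p)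
  subProduct-bottom S lo zero p = cong (λ y → step S y p) (+-identityʳ lo)
  subProduct-bottom S lo (suc k) p =
    trans (subProduct-bottom S lo k (step S (lo + suc k) p))
          (cong (λ y → step S lo (subProduct S (suc lo) k (step S y p))) (+-suc lo k))

  subProduct-cong : ∀ {S S′} lo k p → (∀ y → lo ≤ y → y < lo + k → S y ≡ S′ y) →
    subProduct S lo k p ≡ subProduct S′ lo k p
  subProduct-cong lo zero p _ = refl
  subProduct-cong {S} {S′} lo (suc k) p S≗S′ =
    trans (cong (λ b → subProduct S lo k (if b then letterAct (lo + k) p else p))
                (S≗S′ (lo + k) (m≤m+n lo k) (+-monoʳ-< lo ≤-refl)))
          (subProduct-cong lo k _ (λ y lo≤y y<lo+k → S≗S′ y lo≤y (<-trans y<lo+k (+-monoʳ-< lo ≤-refl))))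

  wordAct-prefix : ∀ k p → wordAct n (take k (Rword n a)) p ≡ subProduct full 1 k p
  wordAct-prefix zero p = refl
  wordAct-prefix (suc k) p = trans (wordAct-take-suc n (Rword n a) k p) (wordAct-prefix k _)

  wordAct-subword : ∀ k lo {J} p → AllPairs _<_ J → All (λ y → lo ≤ y × y < lo + k) J →
    wordAct n (map (R n a) J) p ≡ subProduct (member J) lo k p
  wordAct-subword zero lo p [] [] = refl
  wordAct-subword zero lo p (_ ∷ _) ((lo≤y , y<lo+0) ∷ _) =
    contradiction (≤-<-trans lo≤y y<lo+0) (<-irrefl (sym (+-identityʳ lo)))
  wordAct-subword (suc k) lo {[]} p [] [] =
    trans (wordAct-subword k (suc lo) p [] []) (sym (subProduct-bottom (member []) lo k p))
  wordAct-subword (suc k) lo {y ∷ J} p (y<J ∷ sorted) ((lo≤y , y<lo+1+k) ∷ bounds) with y ≟ lo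
  ... | yes refl = begin
      letterAct y (wordAct n (map (R n a) J) p)
        ≡⟨ cong (letterAct y) (wordAct-subword k (suc y) p sorted (All.zipWith shift (y<J , bounds))) ⟩
      letterAct y (subProduct (member J) (suc y) k p)
        ≡⟨ cong (letterAct y) (subProduct-cong (suc y) k p (λ y′ y<y′ _ → sym (member-there (≢-sym (<⇒≢ y<y′))))) ⟩
      letterAct y (subProduct (member (y ∷ J)) (suc y) k p)
        ≡⟨ step-selected {member (y ∷ J)} {y} _ (member-here y J) ⟨
      step (member (y ∷ J)) y (subProduct (member (y ∷ J)) (suc y) k p)
        ≡⟨ subProduct-bottom (member (y ∷ J)) y k p ⟨
      subProduct (member (y ∷ J)) y (suc k) p ∎
    where
    open ≡-Reasoning
    shift : ∀ {x} → y < x × y ≤ x × x < y + suc k → suc y ≤ x × x < suc y + k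
    shift {x} (y<x , _ , x<) = y<x , subst (x <_) (+-suc y k) x<
  ... | no y≢lo =
    trans (wordAct-subword k (suc lo) p (y<J ∷ sorted) (All.zipWith shift (lo<y∷J , (lo≤y , y<lo+1+k) ∷ bounds)))
          (sym (trans (subProduct-bottom (member (y ∷ J)) lo k p)
                      (step-skipped {member (y ∷ J)} {lo} _ (member-below lo<y∷J))))
    where
    lo<y : lo < y
    lo<y = ≤∧≢⇒< lo≤y (≢-sym y≢lo)
    lo<y∷J : All (lo <_) (y ∷ J)
    lo<y∷J = lo<y ∷ All.map (<-trans lo<y) y<J
    shift : ∀ {x} → lo < x × lo ≤ x × x < lo + suc k → suc lo ≤ x × x < suc lo + k
    shift {x} (lo<x , _ , x<) = lo<x , subst (x <_) (+-suc lo k) x<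

  WireBelow : ℕ → ℕ → ℕ → Set
  WireBelow z k p = ∀ y → 1 ≤ y → y ≤ k → letterAct y p ≢ p → HeapLe n a y z

  -- Following p backwards through the letters k, k − 1, …, 1, only letters
  -- adjacent in the heap to the previous moving letter can move it.
  subProduct-wire : ∀ {z S} → z ≤ N → (∀ y → HeapLe n a y z → S y ≡ true) →
    ∀ k p → k < z → WireBelow z k p → subProduct S 1 k p ≡ subProduct full 1 k p
  subProduct-wire z≤N _ zero p _ _ = refl
  subProduct-wire {z} {S} z≤N S⊇ (suc k) p k<z below with letterAct (suc k) p ≟ p
  ... | yes fixed = begin
      subProduct S 1 k (step S (suc k) p)
        ≡⟨ cong (subProduct S 1 k) (step-fixed S fixed) ⟩
      subProduct S 1 k p
        ≡⟨ subProduct-wire z≤N S⊇ k p (<-trans (n<1+n k) k<z) below′ ⟩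
      subProduct full 1 k p
        ≡⟨ cong (subProduct full 1 k) fixed ⟨
      subProduct full 1 k (letterAct (suc k) p) ∎
    where
    open ≡-Reasoning
    below′ : WireBelow z k p
    below′ y 1≤y y≤k = below y 1≤y (m≤n⇒m≤1+n y≤k)
  ... | no moved = begin
      subProduct S 1 k (step S (suc k) p)
        ≡⟨ cong (subProduct S 1 k) (step-selected {S} {suc k} p (S⊇ (suc k) k+1≤z)) ⟩
      subProduct S 1 k (letterAct (suc k) p)
        ≡⟨ subProduct-wire z≤N S⊇ k _ (<-trans (n<1+n k) k<z) below′ ⟩
      subProduct full 1 k (letterAct (suc k) p) ∎
    where
    open ≡-Reasoning
    k+1≤z : HeapLe n a (suc k) z
    k+1≤z = below (suc k) (s≤s z≤n) ≤-refl moved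
    below′ : WireBelow z k (letterAct (suc k) p)
    below′ y 1≤y y≤k moved′ =
      (1≤y , s≤s y≤k , ≤-trans (<⇒≤ k<z) z≤N ,
       touches-near (proj₁ (sAct-moved n (R n a y) _ moved′)) (proj₂ (sAct-moved n (R n a (suc k)) p moved))) ◅ k+1≤z

  subProduct-agrees : ∀ {S k} → DownClosed S → S (suc k) ≡ true → suc k ≤ N →
    ∀ {y} → Touches (R n a (suc k)) y → subProduct S 1 k y ≡ subProduct full 1 k y
  subProduct-agrees {S} {k} closed Sk k<N {y} touched =
    subProduct-wire k<N (λ x x≤k+1 → closed x (suc k) x≤k+1 Sk) k y (n<1+n k) below
    where
    below : WireBelow (suc k) k y
    below x 1≤x x≤k moved =
      (1≤x , s≤s x≤k , k<N , touches-near (proj₁ (sAct-moved n (R n a x) y moved)) touched) ◅ ε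

  -- coordinate K stands for the heap element N ∸ toℕ K, as in oVec
  indicator : (ℕ → Bool) → Fin N → ℚ
  indicator P K = ind (P (N ∸ toℕ K))

  heapElem-positive : ∀ K → 1 ≤ N ∸ toℕ K
  heapElem-positive K = m<n⇒0<n∸m (toℕ<n K)

  module _ (U : Fin N → Fin N → ℚ) where

    UΠX : (ℕ → ℕ) → Fin N → ℚ
    UΠX f = mulMV U (Pi n a (funMatrix f))

    UΠX-cong : ∀ {f g} → (∀ x → f x ≡ g x) → ∀ K → UΠX f K ≡ UΠX g K
    UΠX-cong f≗g = mulMV-cong U (Pi-cong n a (funMatrix-cong f≗g))

    UΠX-evalWord : ∀ ws K → mulMV U (Pi n a (X (evalWord n ws))) K ≡ UΠX (wordAct n ws) K
    UΠX-evalWord ws = mulMV-cong U (Pi-cong n a (X-evalWord n ws))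

    UΠX-exchange : ∀ r {f g} → (∀ {y} → Touches r y → f y ≡ g y) → ∀ K →
      UΠX (f ∘ sAct n r) K +ℚ UΠX g K ≡ UΠX (g ∘ sAct n r) K +ℚ UΠX f K
    UΠX-exchange r {f} {g} agree K =
      trans (mulMV-+ U _ _ K) (trans (mulMV-cong U exchanged K) (sym (mulMV-+ U _ _ K)))
      where
      exchanged = Pi-+-cong n a {funMatrix (f ∘ sAct n r)} {funMatrix g} {funMatrix (g ∘ sAct n r)} {funMatrix f}
                    (funMatrix-exchange n r agree)

    UΠX-selected : ∀ {S k} → DownClosed S → S (suc k) ≡ true → suc k ≤ N → ∀ K →
      UΠX (subProduct S 1 (suc k)) K +ℚ UΠX (subProduct full 1 k) K ≡
      UΠX (subProduct full 1 (suc k)) K +ℚ UΠX (subProduct S 1 k) K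
    UΠX-selected {S} {k} closed Sk k<N K =
      trans (cong (_+ℚ UΠX (subProduct full 1 k) K) (UΠX-cong (λ p → cong (subProduct S 1 k) (step-selected {S} p Sk)) K))
            (UΠX-exchange (R n a (suc k)) (subProduct-agrees closed Sk k<N) K)

    module _ (isUc : IsUc n a U) (U-identity : ∀ K → UΠX id K ≡ 0ℚ) where

      UΠX-prefix : ∀ k → k ≤ N → ∀ K → UΠX (subProduct full 1 k) K ≡ indicator (λ m → ⌊ m ≤? k ⌋) K
      UΠX-prefix zero _ K =
        trans (U-identity K) (cong ind (sym (⌊⌋-false (_ ≤? 0) (<⇒≱ (heapElem-positive K)))))
      UΠX-prefix (suc k) k<N K = begin
        UΠX (subProduct full 1 (suc k)) K
          ≡⟨ UΠX-cong (λ p → sym (wordAct-prefix (suc k) p)) K ⟩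
        UΠX (wordAct n (take (suc k) (Rword n a))) K
          ≡⟨ UΠX-evalWord (take (suc k) (Rword n a)) K ⟨
        mulMV U (Pi n a (X (bElem n a (suc k)))) K
          ≡⟨ proj₂ isUc (suc k) (s≤s z≤n) k<N K ⟩
        oVec n (range1 (suc k)) K
          ≡⟨ cong ind (⌊⌋-⇔ (proj₂ ∘ ∈-range1⁻) (∈-range1⁺ ∘ (heapElem-positive K ,_)) _ _) ⟩
        indicator (λ m → ⌊ m ≤? suc k ⌋) K ∎
        where open ≡-Reasoning

      UΠX-subProduct : ∀ {S} → DownClosed S → ∀ k → k ≤ N → ∀ K →
        UΠX (subProduct S 1 k) K ≡ indicator (λ m → S m ∧ ⌊ m ≤? k ⌋) K
      UΠX-subProduct {S} _ zero _ K =
        trans (UΠX-prefix zero z≤n K) (cong ind (trans m≰0 (sym (trans (cong (S m ∧_) m≰0) (∧-zeroʳ (S m))))))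
        where
        m = N ∸ toℕ K
        m≰0 : ⌊ m ≤? 0 ⌋ ≡ false
        m≰0 = ⌊⌋-false (m ≤? 0) (<⇒≱ (heapElem-positive K))
      UΠX-subProduct {S} closed (suc k) k<N K = extend (S (suc k)) refl
        where
        open ≡-Reasoning
        m = N ∸ toℕ K
        IH : UΠX (subProduct S 1 k) K ≡ indicator (λ m → S m ∧ ⌊ m ≤? k ⌋) K
        IH = UΠX-subProduct closed k (<⇒≤ k<N) K
        extend : ∀ b → S (suc k) ≡ b → UΠX (subProduct S 1 (suc k)) K ≡ indicator (λ m → S m ∧ ⌊ m ≤? suc k ⌋) K
        extend false Sk = begin
          UΠX (subProduct S 1 (suc k)) K
            ≡⟨ UΠX-cong (λ p → cong (subProduct S 1 k) (step-skipped {S} p Sk)) K ⟩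
          UΠX (subProduct S 1 k) K
            ≡⟨ IH ⟩
          indicator (λ m → S m ∧ ⌊ m ≤? k ⌋) K
            ≡⟨ cong ind (truncation-skipped S k m Sk) ⟨
          indicator (λ m → S m ∧ ⌊ m ≤? suc k ⌋) K ∎
        extend true Sk = ∙-cancelʳ (UΠX (subProduct full 1 k) K) _ _ (begin
          UΠX (subProduct S 1 (suc k)) K +ℚ UΠX (subProduct full 1 k) K
            ≡⟨ UΠX-selected closed Sk k<N K ⟩
          UΠX (subProduct full 1 (suc k)) K +ℚ UΠX (subProduct S 1 k) K
            ≡⟨ cong₂ _+ℚ_ (UΠX-prefix (suc k) k<N K) IH ⟩
          ind ⌊ m ≤? suc k ⌋ +ℚ ind (S m ∧ ⌊ m ≤? k ⌋)
            ≡⟨ truncation-selected S k m Sk ⟨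
          ind (S m ∧ ⌊ m ≤? suc k ⌋) +ℚ ind ⌊ m ≤? k ⌋
            ≡⟨ cong (ind (S m ∧ ⌊ m ≤? suc k ⌋) +ℚ_) (UΠX-prefix k (<⇒≤ k<N) K) ⟨
          ind (S m ∧ ⌊ m ≤? suc k ⌋) +ℚ UΠX (subProduct full 1 k) K ∎)

      UΠX-orderIdeal : ∀ I → IsOrderIdeal n a I → ∀ K → mulMV U (Pi n a (X (idealElem n a I))) K ≡ oVec n I K
      UΠX-orderIdeal I (linked , bounded , closed) K = begin
        mulMV U (Pi n a (X (idealElem n a I))) K
          ≡⟨ UΠX-evalWord (map (R n a) I) K ⟩
        UΠX (wordAct n (map (R n a) I)) K
          ≡⟨ UΠX-cong (λ p → wordAct-subword N 1 p sorted bounded′) K ⟩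
        UΠX (subProduct (member I) 1 N) K
          ≡⟨ UΠX-subProduct member-closed N ≤-refl K ⟩
        ind (member I m ∧ ⌊ m ≤? N ⌋)
          ≡⟨ cong (λ b → ind (member I m ∧ b)) (⌊⌋-true (m ≤? N) (m∸n≤m N (toℕ K))) ⟩
        ind (member I m ∧ true)
          ≡⟨ cong ind (∧-identityʳ (member I m)) ⟩
        oVec n I K ∎
        where
        open ≡-Reasoning
        m = N ∸ toℕ K
        sorted = Linked⇒AllPairs <-trans linked
        bounded′ = All.map (λ (1≤z , z≤N) → 1≤z , s≤s z≤N) bounded
        member-closed : DownClosed (member I)
        member-closed x y x≤y y∈I = ⌊⌋-true (x ∈? I) (closed x y (member-sound y∈I) x≤y)

-- The Coxeter element

OffDiagonal : ℕ × ℕ → Set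
OffDiagonal p = suc (pred (proj₁ p)) ≢ proj₂ p

offDiagonal-above : ∀ {i j} → 1 ≤ i → i < j → OffDiagonal (i , j)
offDiagonal-above {suc i} _ i<j refl = <-irrefl refl i<j

offDiagonal-below : ∀ {i j} → j < i → OffDiagonal (i , j)
offDiagonal-below {suc i} j<i refl = <-irrefl refl j<i

funMatrix-id-offDiagonal : ∀ p → OffDiagonal p → funMatrix id (proj₁ p) (proj₂ p) ≡ 0ℚ
funMatrix-id-offDiagonal _ off = cong ind (≡ᵇ-false off)

downFrom1-bounds : ∀ k → All (λ i → 1 ≤ i × i ≤ k) (downFrom1 k)
downFrom1-bounds zero = []
downFrom1-bounds (suc k) = (s≤s z≤n , ≤-refl) ∷ All.map (Product.map₂ m≤n⇒m≤1+n) (downFrom1-bounds k)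

above-column : ∀ {d} → All (λ i → OffDiagonal (i , d)) (downFrom1 (d ∸ 1))
above-column {d} = All.map (λ (1≤i , i≤d-1) → offDiagonal-above 1≤i (below d 1≤i i≤d-1)) (downFrom1-bounds (d ∸ 1))
  where
  below : ∀ d {i} → 1 ≤ i → i ≤ d ∸ 1 → i < d
  below zero (s≤s z≤n) ()
  below (suc d) _ i≤d = s≤s i≤d

module CoxeterWord (n : ℕ) (a : List ℕ) (cox : IsCoxeterWord n a) where

  idx : ℕ → ℕ
  idx l = indexOf l a

  length-a : length a ≡ n
  length-a = trans (↭-length cox) (trans (length-map suc (upTo n)) (length-upTo n))

  unique-a : Unique a
  unique-a = Unique-resp-↭ (setoid ℕ) (↭⇒↭ₛ (↭-sym cox)) (Unique.map⁺ suc-injective (Unique.upTo⁺ n))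

  idx-inRange : ∀ {l} → InRange n l → idx l < n × nthD 0 (idx l) a ≡ l
  idx-inRange r = Product.map₁ (subst (_ <_) length-a) (indexOf-∈ (∈-resp-↭ (↭-sym cox) (∈-range1⁺ r)))

  idx-outOfRange : ∀ {l} → ¬ InRange n l → idx l ≡ n
  idx-outOfRange ¬r = trans (indexOf-∉ (¬r ∘ ∈-range1⁻ ∘ ∈-resp-↭ cox)) length-a

  idx-nthD : ∀ {i} → i < n → idx (nthD 0 i a) ≡ i
  idx-nthD i<n = indexOf-nthD unique-a _ (subst (_ <_) (sym length-a) i<n)

  idx-injective : ∀ {l l′} → InRange n l → InRange n l′ → idx l ≡ idx l′ → l ≡ l′
  idx-injective r r′ eq = trans (sym (proj₂ (idx-inRange r))) (trans (cong (λ i → nthD 0 i a) eq) (proj₂ (idx-inRange r′)))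

  -- on 2 ≤ w ≤ n this says that w is lower-barred
  Lower : ℕ → Set
  Lower w = idx (w ∸ 1) < idx w

  lower? : Decidable Lower
  lower? w = idx (w ∸ 1) <? idx w

  ¬lower-0 : ¬ Lower 0
  ¬lower-0 = <-irrefl refl

  idx-≤ : ∀ l → idx l ≤ n
  idx-≤ l = subst (idx l ≤_) length-a (indexOf-≤ l a)

  ¬lower-1 : ¬ Lower 1
  ¬lower-1 idx0<idx1 = <⇒≱ (subst (_< idx 1) (idx-outOfRange (λ ())) idx0<idx1) (idx-≤ 1)

  upper-idx : ∀ {y} → 2 ≤ y → y ≤ n → ¬ Lower y → idx y < idx (y ∸ 1)
  upper-idx {suc zero} (s≤s ()) _ _
  upper-idx {suc (suc y)} _ y≤n ¬lower with <-cmp (idx (suc y)) (idx (suc (suc y)))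
  ... | tri< lower _ _ = contradiction lower ¬lower
  ... | tri> _ _ upper = upper
  ... | tri≈ _ eq _ = contradiction (sym (idx-injective (s≤s z≤n , <⇒≤ y≤n) (s≤s z≤n , y≤n) eq)) 1+n≢n

  letter-fixes : ∀ {i} x → i < n → i ≢ idx (x ∸ 1) → i ≢ idx x → sAct n (nthD 0 i a) x ≡ x
  letter-fixes {i} x i<n i≢ i≢′ = sAct-fixes n _ x untouched
    where
    untouched : ¬ Touches (nthD 0 i a) x
    untouched (inj₁ refl) = i≢′ (sym (idx-nthD i<n))
    untouched (inj₂ refl) = i≢ (sym (idx-nthD i<n))

  Outside : ℕ → ℕ → ℕ → Set
  Outside j k m = m < j ⊎ k ≤ m

  take-skip : ∀ {j k} x → j ≤ k → k ≤ n → Outside j k (idx (x ∸ 1)) → Outside j k (idx x) →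
    wordAct n (take k a) x ≡ wordAct n (take j a) x
  take-skip x j≤k k≤n out out′ =
    wordAct-take-skip n a x j≤k (λ i j≤i i<k → letter-fixes x (<-≤-trans i<k k≤n) (apart j≤i i<k out) (apart j≤i i<k out′))
    where
    apart : ∀ {i j k m} → j ≤ i → i < k → Outside j k m → i ≢ m
    apart j≤i _ (inj₁ m<j) refl = <⇒≱ m<j j≤i
    apart _ i<k (inj₂ k≤m) refl = <⇒≱ i<k k≤m

  take-hit : ∀ {l} x → InRange n l → wordAct n (take (suc (idx l)) a) x ≡ wordAct n (take (idx l) a) (sAct n l x)
  take-hit {l} x r =
    trans (wordAct-take-suc n a (idx l) x) (cong (λ m → wordAct n (take (idx l) a) (sAct n m x)) (proj₂ (idx-inRange r)))

  wordAct-take-n : ∀ x → wordAct n a x ≡ wordAct n (take n a) x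
  wordAct-take-n x = cong (λ L → wordAct n L x) (sym (take-all n a (≤-reflexive length-a)))

  sAct-up : ∀ {y} → InRange n y → sAct n y y ≡ suc y
  sAct-up {y} r = trans (sAct-inRange y r) (swap-left y)

  sAct-down : ∀ {y} → InRange n y → sAct n y (suc y) ≡ y
  sAct-down {y} r = trans (sAct-inRange (suc y) r) (swap-right y)

  record PrevUpper (x z : ℕ) : Set where
    field
      positive : 1 ≤ z
      below : z < x
      upper : ¬ Lower z
      lowerBetween : ∀ w → z < w → w < x → Lower w

  record NextLower (x z : ℕ) : Set where
    field
      above : x < z
      lower : Lower z
      upperBetween : ∀ w → x < w → w < z → ¬ Lower w

  prevUpper-extend : ∀ {x z} → PrevUpper x z → Lower x → PrevUpper (suc x) z
  prevUpper-extend {x} {z} prev lower = record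
    { positive = positive ; below = m<n⇒m<1+n below ; upper = upper ; lowerBetween = lowerBetween′ }
    where
    open PrevUpper prev
    lowerBetween′ : ∀ w → z < w → w < suc x → Lower w
    lowerBetween′ w z<w w<1+x with m≤n⇒m<n∨m≡n (s≤s⁻¹ w<1+x)
    ... | inj₁ w<x = lowerBetween w z<w w<x
    ... | inj₂ refl = lower

  nextLower-extend : ∀ {x z} → NextLower (suc x) z → ¬ Lower (suc x) → NextLower x z
  nextLower-extend {x} {z} next ¬lower = record
    { above = <-trans (n<1+n x) above ; lower = lower ; upperBetween = upperBetween′ }
    where
    open NextLower next
    upperBetween′ : ∀ w → x < w → w < z → ¬ Lower w
    upperBetween′ w x<w w<z with m≤n⇒m<n∨m≡n x<w
    ... | inj₁ x+1<w = upperBetween w x+1<w w<z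
    ... | inj₂ refl = ¬lower

  idx-0 : idx 0 ≡ n
  idx-0 = idx-outOfRange (λ ())

  idx-1+n : idx (suc n) ≡ n
  idx-1+n = idx-outOfRange (λ (_ , 1+n≤n) → <-irrefl refl 1+n≤n)

  nothing-between : ∀ {x w} → x < w → w < suc x → ⊥
  nothing-between x<w w<1+x = <⇒≱ x<w (s≤s⁻¹ w<1+x)

  D : ℕ → ℕ
  D y = wordAct n (take (idx y) a) y

  descent-step : ∀ y → 2 + y ≤ n → Dec (Lower (2 + y)) → PrevUpper (2 + y) (D (suc y)) → PrevUpper (3 + y) (D (2 + y))
  descent-step y y+2≤n (yes lower) prev = subst (PrevUpper (3 + y)) (sym dropped) (prevUpper-extend prev lower)
    where
    dropped : D (2 + y) ≡ D (suc y)
    dropped = begin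
      wordAct n (take (idx (2 + y)) a) (2 + y)
        ≡⟨ take-skip (2 + y) lower (idx-≤ _) (inj₁ ≤-refl) (inj₂ ≤-refl) ⟩
      wordAct n (take (suc (idx (suc y))) a) (2 + y)
        ≡⟨ take-hit (2 + y) (s≤s z≤n , <⇒≤ y+2≤n) ⟩
      wordAct n (take (idx (suc y)) a) (sAct n (suc y) (2 + y))
        ≡⟨ cong (wordAct n (take (idx (suc y)) a)) (sAct-down (s≤s z≤n , <⇒≤ y+2≤n)) ⟩
      wordAct n (take (idx (suc y)) a) (suc y) ∎
      where open ≡-Reasoning
  descent-step y y+2≤n (no ¬lower) _ = subst (PrevUpper (3 + y)) (sym fixed) (record
    { positive = s≤s z≤n ; below = ≤-refl ; upper = ¬lower
    ; lowerBetween = λ _ y+2<w w<3+y → ⊥-elim (nothing-between y+2<w w<3+y) })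
    where
    fixed : D (2 + y) ≡ 2 + y
    fixed = take-skip (2 + y) z≤n (idx-≤ _) (inj₂ (<⇒≤ (upper-idx (s≤s (s≤s z≤n)) y+2≤n ¬lower))) (inj₂ ≤-refl)

  descent : ∀ y → 1 ≤ y → y ≤ n → PrevUpper (suc y) (D y)
  descent (suc zero) _ _ = subst (PrevUpper 2) (sym fixed) (record
    { positive = ≤-refl ; below = ≤-refl ; upper = ¬lower-1
    ; lowerBetween = λ _ 1<w w<2 → ⊥-elim (nothing-between 1<w w<2) })
    where
    fixed : D 1 ≡ 1
    fixed = take-skip 1 z≤n (idx-≤ 1) (inj₂ (subst (idx 1 ≤_) (sym idx-0) (idx-≤ 1))) (inj₂ ≤-refl)
  descent (suc (suc y)) _ y+2≤n =
    descent-step y y+2≤n (lower? (2 + y)) (descent (suc y) (s≤s z≤n) (<⇒≤ y+2≤n))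

  A : ℕ → ℕ
  A x = wordAct n (take (idx x) a) (suc x)

  ascent-step : ∀ x → 1 ≤ x → suc x ≤ n → Dec (Lower (suc x)) → NextLower (suc x) (A (suc x)) → NextLower x (A x)
  ascent-step x _ _ (yes lower) _ = subst (NextLower x) (sym fixed) (record
    { above = ≤-refl ; lower = lower
    ; upperBetween = λ _ x<w w<1+x → ⊥-elim (nothing-between x<w w<1+x) })
    where
    fixed : A x ≡ suc x
    fixed = take-skip (suc x) z≤n (idx-≤ x) (inj₂ ≤-refl) (inj₂ (<⇒≤ lower))
  ascent-step x 1≤x x<n (no ¬lower) next = subst (NextLower x) (sym raised) (nextLower-extend next ¬lower)
    where
    raised : A x ≡ A (suc x)
    raised = begin
      wordAct n (take (idx x) a) (suc x)
        ≡⟨ take-skip (suc x) (upper-idx (s≤s 1≤x) x<n ¬lower) (idx-≤ x) (inj₂ ≤-refl) (inj₁ ≤-refl) ⟩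
      wordAct n (take (suc (idx (suc x))) a) (suc x)
        ≡⟨ take-hit (suc x) (s≤s z≤n , x<n) ⟩
      wordAct n (take (idx (suc x)) a) (sAct n (suc x) (suc x))
        ≡⟨ cong (wordAct n (take (idx (suc x)) a)) (sAct-up (s≤s z≤n , x<n)) ⟩
      wordAct n (take (idx (suc x)) a) (2 + x) ∎
      where open ≡-Reasoning

  ascent : ∀ d x → d + x ≡ n → 1 ≤ x → NextLower x (A x)
  ascent zero x refl 1≤x = subst (NextLower x) (sym fixed) (record
    { above = ≤-refl ; lower = idx-x<idx-1+x
    ; upperBetween = λ _ x<w w<1+x → ⊥-elim (nothing-between x<w w<1+x) })
    where
    idx-x<idx-1+x : idx x < idx (suc x)
    idx-x<idx-1+x = subst (idx x <_) (sym idx-1+n) (proj₁ (idx-inRange (1≤x , ≤-refl)))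
    fixed : A x ≡ suc x
    fixed = take-skip (suc x) z≤n (idx-≤ x) (inj₂ ≤-refl) (inj₂ (<⇒≤ idx-x<idx-1+x))
  ascent (suc d) x d+x≡n 1≤x =
    ascent-step x 1≤x x<n (lower? (suc x)) (ascent d (suc x) (trans (+-suc d x) d+x≡n) (s≤s z≤n))
    where
    x<n : suc x ≤ n
    x<n = subst (suc x ≤_) d+x≡n (s≤s (m≤n+m x d))

  c-upper : ∀ x → 2 ≤ x → x ≤ n → ¬ Lower x → PrevUpper x (wordAct n a x)
  c-upper (suc zero) (s≤s ()) _ _
  c-upper (suc (suc y)) _ y+2≤n ¬lower = subst (PrevUpper (2 + y)) (sym dropped) (descent (suc y) (s≤s z≤n) y+1≤n)
    where
    y+1≤n = <⇒≤ y+2≤n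
    dropped : wordAct n a (2 + y) ≡ D (suc y)
    dropped = begin
      wordAct n a (2 + y)
        ≡⟨ wordAct-take-n (2 + y) ⟩
      wordAct n (take n a) (2 + y)
        ≡⟨ take-skip (2 + y) (proj₁ (idx-inRange (s≤s z≤n , y+1≤n))) ≤-refl
             (inj₁ ≤-refl) (inj₁ (m<n⇒m<1+n (upper-idx (s≤s (s≤s z≤n)) y+2≤n ¬lower))) ⟩
      wordAct n (take (suc (idx (suc y))) a) (2 + y)
        ≡⟨ take-hit (2 + y) (s≤s z≤n , y+1≤n) ⟩
      wordAct n (take (idx (suc y)) a) (sAct n (suc y) (2 + y))
        ≡⟨ cong (wordAct n (take (idx (suc y)) a)) (sAct-down (s≤s z≤n , y+1≤n)) ⟩
      D (suc y) ∎
      where open ≡-Reasoning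

  c-lower : ∀ x → 1 ≤ x → x ≤ n → x ≡ 1 ⊎ Lower x → NextLower x (wordAct n a x)
  c-lower x 1≤x x≤n one-or-lower = subst (NextLower x) (sym raised) (ascent (n ∸ x) x (m∸n+n≡m x≤n) 1≤x)
    where
    left-outside : x ≡ 1 ⊎ Lower x → Outside (suc (idx x)) n (idx (x ∸ 1))
    left-outside (inj₁ refl) = inj₂ (≤-reflexive (sym idx-0))
    left-outside (inj₂ lower) = inj₁ (m<n⇒m<1+n lower)
    raised : wordAct n a x ≡ A x
    raised = begin
      wordAct n a x
        ≡⟨ wordAct-take-n x ⟩
      wordAct n (take n a) x
        ≡⟨ take-skip x (proj₁ (idx-inRange (1≤x , x≤n))) ≤-refl (left-outside one-or-lower) (inj₁ ≤-refl) ⟩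
      wordAct n (take (suc (idx x)) a) x
        ≡⟨ take-hit x (1≤x , x≤n) ⟩
      wordAct n (take (idx x) a) (sAct n x x)
        ≡⟨ cong (wordAct n (take (idx x) a)) (sAct-up (1≤x , x≤n)) ⟩
      A x ∎
      where open ≡-Reasoning

  Upper : ℕ → Set
  Upper w = 1 ≤ w × ¬ Lower w

  upper? : Decidable Upper
  upper? w = (1 ≤? w) ×-dec ¬? (lower? w)

  #upper #lower : ℕ → ℕ
  #upper = count upper?
  #lower = count lower?

  #upper-1 : #upper 1 ≡ 0
  #upper-1 = count-miss upper? {0} λ { (() , _) }

  #lower-2 : #lower 2 ≡ 0
  #lower-2 = trans (count-miss lower? ¬lower-1) (count-miss lower? ¬lower-0)

  #upper+#lower : ∀ y → #upper (suc y) + #lower (suc y) ≡ y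
  #upper+#lower zero = cong₂ _+_ #upper-1 (count-miss lower? ¬lower-0)
  #upper+#lower (suc y) = extend (lower? (suc y))
    where
    open ≡-Reasoning
    extend : Dec (Lower (suc y)) → #upper (2 + y) + #lower (2 + y) ≡ suc y
    extend (yes lower) = begin
      #upper (2 + y) + #lower (2 + y)
        ≡⟨ cong₂ _+_ (count-miss upper? (λ (_ , ¬lower) → ¬lower lower)) (count-hit lower? lower) ⟩
      #upper (suc y) + suc (#lower (suc y))
        ≡⟨ +-suc _ _ ⟩
      suc (#upper (suc y) + #lower (suc y))
        ≡⟨ cong suc (#upper+#lower y) ⟩
      suc y ∎
    extend (no ¬lower) = begin
      #upper (2 + y) + #lower (2 + y)
        ≡⟨ cong₂ _+_ (count-hit upper? (s≤s z≤n , ¬lower)) (count-miss lower? ¬lower) ⟩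
      suc (#upper (suc y) + #lower (suc y))
        ≡⟨ cong suc (#upper+#lower y) ⟩
      suc y ∎

  #upper-prevUpper : ∀ {x z} → PrevUpper x z → #upper x ≡ suc (#upper z)
  #upper-prevUpper prev =
    trans (count-skip upper? below (λ w z<w w<x (_ , ¬lower) → ¬lower (lowerBetween w z<w w<x)))
          (count-hit upper? (positive , upper))
    where open PrevUpper prev

  #lower-nextLower : ∀ {x z v} → NextLower x z → x < v → v ≤ z → #lower v ≡ #lower (suc x)
  #lower-nextLower next x<v v≤z = count-skip lower? x<v (λ w x<w w<v → upperBetween w x<w (<-≤-trans w<v v≤z))
    where open NextLower next

  lower-positive : ∀ {v} → Lower v → 1 ≤ v
  lower-positive {zero} lower = contradiction lower ¬lower-0
  lower-positive {suc v} _ = s≤s z≤n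

  module Orbit (y : ℕ) (1≤y : 1 ≤ y) (u≤n : suc y ≤ n) (u-upper : ¬ Lower (suc y)) where

    c : ℕ → ℕ
    c = wordAct n a

    u : ℕ
    u = suc y

    -- v < u is reached from u after t steps: down through the upper-barred numbers, then up from 1
    data OrbitPoint (t v : ℕ) : Set where
      atUpper : 1 ≤ v → v < u → ¬ Lower v → #upper u ≡ t + #upper v → OrbitPoint t v
      atLower : v < u → Lower v → t ≡ suc (#upper u + #lower v) → OrbitPoint t v

    orbitPoint-below : ∀ {t v} → OrbitPoint t v → v < u
    orbitPoint-below (atUpper _ v<u _ _) = v<u
    orbitPoint-below (atLower v<u _ _) = v<u

    orbit-start : OrbitPoint 1 (c u)
    orbit-start = atUpper positive below upper (#upper-prevUpper prev)
      where
      prev = c-upper u (s≤s 1≤y) u≤n u-upper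
      open PrevUpper prev

    no-escape : ∀ {t} → t < y → t ≢ #upper u + #lower u
    no-escape t<y eq = <-irrefl (trans eq (#upper+#lower y)) t<y

    ascend : ∀ {t x} → t < y → x < u → NextLower x (c x) →
      (∀ {v′} → x < v′ → v′ ≤ c x → t ≡ #upper u + #lower v′) → OrbitPoint (suc t) (c x)
    ascend {x = x} t<y x<u next steps with c x <? u
    ... | yes cx<u = atLower cx<u (NextLower.lower next) (cong suc (steps (NextLower.above next) ≤-refl))
    ... | no cx≮u = ⊥-elim (no-escape t<y (steps x<u (≮⇒≥ cx≮u)))

    orbit-step : ∀ {t v} → t < y → OrbitPoint t v → OrbitPoint (suc t) (c v)
    orbit-step {t} {suc zero} t<y (atUpper _ 1<u _ eq) = ascend t<y 1<u next steps
      where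
      next = c-lower 1 ≤-refl (≤-trans (s≤s z≤n) u≤n) (inj₁ refl)
      steps : ∀ {v′} → 1 < v′ → v′ ≤ c 1 → t ≡ #upper u + #lower v′
      steps {v′} 1<v′ v′≤c1 = begin
        t                    ≡⟨ +-identityʳ t ⟨
        t + 0                ≡⟨ cong (t +_) #upper-1 ⟨
        t + #upper 1         ≡⟨ eq ⟨
        #upper u             ≡⟨ +-identityʳ _ ⟨
        #upper u + 0         ≡⟨ cong (#upper u +_) (trans (#lower-nextLower next 1<v′ v′≤c1) #lower-2) ⟨
        #upper u + #lower v′ ∎
        where open ≡-Reasoning
    orbit-step {t} {suc (suc v)} _ (atUpper _ v<u ¬lower eq) =
      atUpper positive (<-trans below v<u) upper (trans eq (trans (cong (t +_) (#upper-prevUpper prev)) (+-suc t _)))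
      where
      prev = c-upper (2 + v) (s≤s (s≤s z≤n)) (≤-trans (<⇒≤ v<u) u≤n) ¬lower
      open PrevUpper prev
    orbit-step {t} {v} t<y (atLower v<u lowerᵥ eq) = ascend t<y v<u next steps
      where
      next = c-lower v (lower-positive lowerᵥ) (≤-trans (<⇒≤ v<u) u≤n) (inj₂ lowerᵥ)
      steps : ∀ {v′} → v < v′ → v′ ≤ c v → t ≡ #upper u + #lower v′
      steps {v′} v<v′ v′≤cv = begin
        t                         ≡⟨ eq ⟩
        suc (#upper u + #lower v) ≡⟨ +-suc _ _ ⟨
        #upper u + suc (#lower v) ≡⟨ cong (#upper u +_) (count-hit lower? lowerᵥ) ⟨
        #upper u + #lower (suc v) ≡⟨ cong (#upper u +_) (#lower-nextLower next v<v′ v′≤cv) ⟨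
        #upper u + #lower v′      ∎
        where open ≡-Reasoning

    orbit : ∀ t → 1 ≤ t → t ≤ y → OrbitPoint t (iterate c t u)
    orbit (suc zero) _ _ = orbit-start
    orbit (suc (suc t)) _ t+2≤y = orbit-step t+2≤y (orbit (suc t) (s≤s z≤n) (<⇒≤ t+2≤y))

    orbit-below : ∀ t → 1 ≤ t → t ≤ y → iterate c t u < u
    orbit-below t 1≤t t≤y = orbitPoint-below (orbit t 1≤t t≤y)

  iterate-positive : ∀ t {x} → 1 ≤ x → 1 ≤ iterate (wordAct n a) t x
  iterate-positive zero 1≤x = 1≤x
  iterate-positive (suc t) 1≤x = wordAct-positive n a (iterate-positive t 1≤x)

  iterate-app : ∀ t {x} → 1 ≤ x → iterate (app (coxElem n a)) t x ≡ iterate (wordAct n a) t x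
  iterate-app zero _ = refl
  iterate-app (suc t) 1≤x = trans (cong (app (coxElem n a)) (iterate-app t 1≤x)) (app-c (iterate-positive t 1≤x))
    where
    app-c : ∀ {y} → 1 ≤ y → app (coxElem n a) y ≡ wordAct n a y
    app-c {suc y} _ = app-evalWord n a (suc y)

  uppers-bounds : ∀ {u} → u ∈ uppers n a → ∃ λ y → u ≡ suc y × 1 ≤ y × suc y ≤ n × ¬ Lower (suc y)
  uppers-bounds u∈ with ∈-filter⁻ (λ i → ¬? (lower? i)) {xs = range2 n} u∈
  ... | u∈range2 , ¬lower with ∈-map⁻ (λ k → k + 2) u∈range2
  ...   | k , k∈ , refl = suc k , +-comm k 2 , s≤s z≤n , k+2≤n (∈-upTo⁻ k∈) , subst (¬_ ∘ Lower) (+-comm k 2) ¬lower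
    where
    k+2≤n : ∀ {k n} → k < n ∸ 1 → 2 + k ≤ n
    k+2≤n {n = suc n} k<n = s≤s k<n

  uBlock-offDiagonal : ∀ {u} → u ∈ uppers n a → All OffDiagonal (uBlock n (coxElem n a) u)
  uBlock-offDiagonal u∈ with uppers-bounds u∈
  ... | y , refl , 1≤y , u≤n , ¬lower =
    ++⁺ (map⁺ (All.tabulate orbit-entry))
        (All-if ⌊ n + 2 <? 2 * suc y ⌋ (map⁺ {f = λ i → (i , suc y)} (take⁺ (y ∸ m) above-column)))
    where
    open Orbit y 1≤y u≤n ¬lower using (orbit-below)
    m = y ⊓ (suc n ∸ suc y)
    orbit-entry : ∀ {t} → t ∈ range1 m → OffDiagonal (n + 2 ∸ t , iterate (app (coxElem n a)) t (suc y))
    orbit-entry {t} t∈ = offDiagonal-below (begin-strict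
      iterate (app (coxElem n a)) t (suc y) ≡⟨ iterate-app t (s≤s z≤n) ⟩
      iterate (wordAct n a) t (suc y)       <⟨ orbit-below t 1≤t (≤-trans t≤m (m⊓n≤m _ _)) ⟩
      suc y                                 ≤⟨ u≤1+n∸t ⟩
      suc n ∸ t                             <⟨ ∸-monoˡ-< (n<1+n (suc n)) t≤1+n ⟩
      suc (suc n) ∸ t                       ≡⟨ cong (_∸ t) (+-comm 2 n) ⟩
      n + 2 ∸ t                             ∎)
      where
      open ≤-Reasoning
      1≤t = proj₁ (∈-range1⁻ t∈)
      t≤m = proj₂ (∈-range1⁻ t∈)
      t≤1+n∸u : t ≤ suc n ∸ suc y
      t≤1+n∸u = ≤-trans t≤m (m⊓n≤n _ _)
      t≤1+n : t ≤ suc n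
      t≤1+n = ≤-trans t≤1+n∸u (m∸n≤m (suc n) (suc y))
      u≤1+n∸t : suc y ≤ suc n ∸ t
      u≤1+n∸t = m+n≤o⇒m≤o∸n (suc y) (subst (_≤ suc n) (+-comm t (suc y)) (m≤o∸n⇒m+n≤o t (m≤n⇒m≤1+n u≤n) t≤1+n∸u))

  posList-offDiagonal : All OffDiagonal (posList n a)
  posList-offDiagonal =
    ++⁺ (concat⁺ (map⁺ (All.universal (λ _ → map⁺ above-column) (lowers n a))))
        (++⁺ (map⁺ above-column)
             (concat⁺ (map⁺ (All.tabulate (uBlock-offDiagonal ∘ ∈-resp-↭ (↭-reverse (uppers n a)))))))

  Pi-identity : ∀ K → Pi n a (funMatrix id) K ≡ 0ℚ
  Pi-identity K = funMatrix-id-offDiagonal entry (nthD-All (toℕ K) reversed (λ ()))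
    where
    entry = nthD (0 , 0) (toℕ K) (reverse (posList n a))
    reversed : All OffDiagonal (reverse (posList n a))
    reversed = All-resp-↭ (↭-sym (↭-reverse (posList n a))) posList-offDiagonal

-- Every order ideal satisfies the identity.
theorem6p21 : (n : ℕ) (a : List ℕ) → IsCoxeterWord n a →
    (U : Fin (Nc n) → Fin (Nc n) → ℚ) → IsUc n a U →
    (w : Perm) → IsSingleton n a w →
    (I : List ℕ) → IsOrderIdeal n a I → idealElem n a I ≡ w →
    (k : Fin (Nc n)) → mulMV U (Pi n a (X w)) k ≡ oVec n I k
theorem6p21 n a cox U isUc _ _ I ideal refl =
  UΠX-orderIdeal U isUc (mulMV-zero U Pi-identity) I ideal
  where
  open Heap n a using (UΠX-orderIdeal)
  open CoxeterWord n a cox using (Pi-identity)
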